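{- For every even integer $j\ge0$, every even integer $a_{j+1}\ge2$ and every odd integer $a_{j+2}\ge1$, the tree $RT(0^j,a_{j+1},a_{j+2})$ is super edge-graceful.
   Context: For a finite simple graph $G$ with $p$ vertices and $q$ edges, $G$ is super edge-graceful if there is a bijection $f$ from $E(G)$ onto $\{0,\pm1,\ldots,\pm\frac{q-1}{2}\}$ when $q$ is odd, and onto $\{\pm1,\ldots,\pm\frac{q}{2}\}$ when $q$ is even, such that the induced vertex labeling $f^+(v)=\sum_{uv\in E(G)} f(uv)$ is a bijection from $V(G)$ onto $\{0,\pm1,\ldots,\pm\frac{p-1}{2}\}$ when $p$ is odd, and onto $\{\pm1,\ldots,\pm\frac{p}{2}\}$ when $p$ is even. $RT(0^j,a,b)$ denotes the rooted tree with root $v_0$ having $j+2$ children: $j$ of them are leaves, one has exactly $a$ children (all leaves) and one has exactly $b$ children (all leaves). -}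

module Defs where

open import Data.Nat using (ℕ; zero; suc; _+_; _*_; _<_; _<ᵇ_; _≡ᵇ_)
open import Data.Integer using (ℤ; ∣_∣) renaming (_+_ to _+ℤ_; 0ℤ to 0ℤ)
open import Data.Fin using (Fin; toℕ)
import Data.Fin as Fin
open import Data.Bool using (if_then_else_; _∨_)
open import Data.Product using (_×_; _,_; proj₁; proj₂; ∃)
open import Relation.Binary.PropositionalEquality using (_≡_; _≢_)

-- A finite graph with p vertices 0..p-1 (natural numbers < p) and q edges,
-- the edge e : Fin q joining the two vertices in  ends e.
record Graph : Set where
  field
    p    : ℕ
    q    : ℕ
    ends : Fin q → ℕ × ℕ
open Graph public

sumFin : (n : ℕ) → (Fin n → ℤ) → ℤ
sumFin zero    f = 0ℤ
sumFin (suc n) f = f Fin.zero +ℤ sumFin n (λ i → f (Fin.suc i))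

-- The label set for n:  {0, ±1, …, ±(n-1)/2} if n odd,  {±1, …, ±n/2} if n even.
LabelSet : ℕ → ℤ → Set
LabelSet n z =
  (∀ k → n ≡ 2 * k → (z ≢ 0ℤ) × (∣ z ∣ Data.Nat.≤ k)) ×
  (∀ k → n ≡ suc (2 * k) → ∣ z ∣ Data.Nat.≤ k)

inducedLabel : (G : Graph) → (Fin (q G) → ℤ) → ℕ → ℤ
inducedLabel G f v =
  sumFin (q G) (λ e → if (v ≡ᵇ proj₁ (ends G e)) ∨ (v ≡ᵇ proj₂ (ends G e))
                      then f e else 0ℤ)

EdgeLabelingBij : (G : Graph) → (Fin (q G) → ℤ) → Set
EdgeLabelingBij G f =
  (∀ e → LabelSet (q G) (f e)) ×
  (∀ e e′ → f e ≡ f e′ → e ≡ e′) ×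
  (∀ z → LabelSet (q G) z → ∃ λ e → f e ≡ z)

VertexLabelingBij : (G : Graph) → (ℕ → ℤ) → Set
VertexLabelingBij G g =
  (∀ v → v < p G → LabelSet (p G) (g v)) ×
  (∀ v w → v < p G → w < p G → g v ≡ g w → v ≡ w) ×
  (∀ z → LabelSet (p G) z → ∃ λ v → (v < p G) × (g v ≡ z))

SuperEdgeGraceful : Graph → Set
SuperEdgeGraceful G =
  ∃ λ (f : Fin (q G) → ℤ) →
    EdgeLabelingBij G f × VertexLabelingBij G (inducedLabel G f)

-- Vertices: 0 = root v₀; 1..j the j leaf children of v₀;
-- j+1 = child u with a leaf children j+3 .. j+2+a;
-- j+2 = child w with b leaf children j+3+a .. j+2+a+b.
-- p = j+a+b+3, q = j+a+b+2.  Edge number n joins vertex n+1 to its parent.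
rtParent : ℕ → ℕ → ℕ → ℕ
rtParent j a n =
  if n <ᵇ (j + 2) then 0
  else if n <ᵇ (j + 2 + a) then j + 1
  else j + 2

RT : ℕ → ℕ → ℕ → Graph
RT j a b = record
  { p    = j + a + b + 3
  ; q    = j + a + b + 2
  ; ends = λ e → (rtParent j a (toℕ e) , suc (toℕ e))
  }

module Submission where

-- Put K = m + s + t + 2: the tree has 2K + 1 edges and 2K + 2 vertices.  Group
-- the edges 2i, 2i + 1 into pairs i < K, leaving the single edge 2K.  The m
-- pairs of root leaves get ∓(i + 2), the hub pair m (edges to u and w) gets
-- 0, -1, the first pair m + 1 of leaves of u gets 1, K, and every other pair i
-- gets ∓i (edge 2K gets -K).  This is a bijection onto [-K, K], proved with an
-- explicit inverse.  Outside the hub and the first pair of u the two labels of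
-- a pair cancel, so the child edges of the root, u and w sum to -1, K + 1 and
-- -K; adding the edge to its parent, the root gets -1, u gets K + 1, w gets
-- -(K + 1) and each leaf the label of its edge.  So the vertex labels are the
-- edge labels with 0, -1 traded for ±(K + 1), preceded by -1 at the root: a
-- bijection onto the nonzero labels in [-(K + 1), K + 1].

open import Defs
open import Data.Nat using (ℕ; zero; suc; _+_; _*_; _≤_; _<_; _≡ᵇ_; _<ᵇ_; z≤n; s≤s; s≤s⁻¹; z<s; s<s; s<s⁻¹; ⌊_/2⌋; parity)
open import Data.Nat.Properties using (suc-injective; m<m+n; ≤-<-trans; <-cmp; ≤∧≢⇒<; <-irrefl; <-trans; n<1+n; <⇒≢; +-comm; m≤m+n; <-≤-trans; ≤⇒≯; <⇒≤; ≮⇒≥; +-monoʳ-<; _≟_; _<?_; even≢odd; *-cancelˡ-≡; ≤-refl; ≤-trans; n≤1+n; +-suc; +-assoc; +-identityʳ)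
open import Data.Parity.Base using (Parity; 0ℙ; 1ℙ)
open import Data.Integer using (ℤ; +_; -[1+_]; -_; ∣_∣; 0ℤ; -1ℤ; 1ℤ) renaming (_+_ to _+ℤ_)
import Data.Integer.Properties as ℤ
open import Data.Bool using (true; false; if_then_else_; _∨_)
open import Data.Fin using (toℕ; fromℕ<)
open import Data.Fin.Properties using (toℕ<n; toℕ-injective; toℕ-fromℕ<)
open import Data.Product using (∃; _×_; _,_; proj₁; proj₂)
open import Data.Sum using (_⊎_; inj₁; inj₂; [_,_]′)
open import Function using (_∘_)
open import Function.Bundles using (_⇔_; mk⇔; module Equivalence)
import Function.Properties.Equivalence as ⇔
open import Relation.Nullary using (¬_; yes; no; contradiction)
open import Relation.Nullary.Decidable using (dec-true; dec-false)
open import Relation.Binary.PropositionalEquality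
open import Data.List using (_∷_; [])
open import Data.Nat.Tactic.RingSolver using (solve; solve-∀)
import Data.Integer.Tactic.RingSolver as ℤ-Solver
open import Relation.Binary.Definitions using (tri<; tri≈; tri>)

open Equivalence using (to; from)

-- The Boolean tests used in Defs are the decisions _≟_ and _<?_ with their
-- evidence forgotten, so they evaluate once the relation is decided.
≡ᵇ-yes : ∀ {m n} → m ≡ n → (m ≡ᵇ n) ≡ true
≡ᵇ-yes {m} {n} = dec-true (m ≟ n)

≡ᵇ-no : ∀ {m n} → m ≢ n → (m ≡ᵇ n) ≡ false
≡ᵇ-no {m} {n} = dec-false (m ≟ n)

<ᵇ-yes : ∀ {m n} → m < n → (m <ᵇ n) ≡ true
<ᵇ-yes {m} {n} = dec-true (m <? n)

<ᵇ-no : ∀ {m n} → ¬ m < n → (m <ᵇ n) ≡ false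
<ᵇ-no {m} {n} = dec-false (m <? n)

-- The amount c credited to vertex v if v is x, and nothing otherwise; this is
-- the shape of every summand of an induced vertex label.
onlyAt : ℕ → ℕ → ℤ → ℤ
onlyAt x v c = if v ≡ᵇ x then c else 0ℤ

-- A sequence with a new first term; vertex 0 is the root, vertex n+1 the
-- lower end of edge n.
prepend : ℤ → (ℕ → ℤ) → ℕ → ℤ
prepend z₀ G zero    = z₀
prepend z₀ G (suc n) = G n

sumℕ : ℕ → (ℕ → ℤ) → ℤ
sumℕ zero    G = 0ℤ
sumℕ (suc n) G = G 0 +ℤ sumℕ n (G ∘ suc)

sumFin-toℕ : ∀ n (G : ℕ → ℤ) → sumFin n (G ∘ toℕ) ≡ sumℕ n G
sumFin-toℕ zero    G = refl
sumFin-toℕ (suc n) G = cong (G 0 +ℤ_) (sumFin-toℕ n (G ∘ suc))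

sumℕ-cong : ∀ n {G H : ℕ → ℤ} → (∀ i → i < n → G i ≡ H i) → sumℕ n G ≡ sumℕ n H
sumℕ-cong zero    eq = refl
sumℕ-cong (suc n) eq = cong₂ _+ℤ_ (eq 0 z<s) (sumℕ-cong n (λ i i<n → eq (suc i) (s<s i<n)))

sumℕ-zero : ∀ n → sumℕ n (λ _ → 0ℤ) ≡ 0ℤ
sumℕ-zero zero    = refl
sumℕ-zero (suc n) = trans (ℤ.+-identityˡ _) (sumℕ-zero n)

sumℕ-vanish : ∀ n {G : ℕ → ℤ} → (∀ i → i < n → G i ≡ 0ℤ) → sumℕ n G ≡ 0ℤ
sumℕ-vanish n eq = trans (sumℕ-cong n eq) (sumℕ-zero n)

sumℕ-+ : ∀ x y (G : ℕ → ℤ) → sumℕ (x + y) G ≡ sumℕ x G +ℤ sumℕ y (λ i → G (x + i))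
sumℕ-+ zero    y G = sym (ℤ.+-identityˡ _)
sumℕ-+ (suc x) y G = trans (cong (G 0 +ℤ_) (sumℕ-+ x y (G ∘ suc))) (sym (ℤ.+-assoc (G 0) _ _))

sumℕ-snoc : ∀ n (G : ℕ → ℤ) → sumℕ (suc n) G ≡ sumℕ n G +ℤ G n
sumℕ-snoc zero    G = ℤ.+-comm (G 0) 0ℤ
sumℕ-snoc (suc n) G = trans (cong (G 0 +ℤ_) (sumℕ-snoc n (G ∘ suc))) (sym (ℤ.+-assoc (G 0) _ _))

sumℕ-distrib : ∀ n (G H : ℕ → ℤ) → sumℕ n (λ i → G i +ℤ H i) ≡ sumℕ n G +ℤ sumℕ n H
sumℕ-distrib zero    G H = refl
sumℕ-distrib (suc n) G H =
  trans (cong ((G 0 +ℤ H 0) +ℤ_) (sumℕ-distrib n (G ∘ suc) (H ∘ suc))) (interchange (G 0) (H 0) _ _)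
  where
  interchange : ∀ w x y z → (w +ℤ x) +ℤ (y +ℤ z) ≡ (w +ℤ y) +ℤ (x +ℤ z)
  interchange = ℤ-Solver.solve-∀

sumℕ-onlyAt : ∀ n x v (G : ℕ → ℤ) → sumℕ n (λ i → onlyAt x v (G i)) ≡ onlyAt x v (sumℕ n G)
sumℕ-onlyAt n x v G with v ≡ᵇ x
... | true  = refl
... | false = sumℕ-zero n

sumℕ-δ : ∀ N (G : ℕ → ℤ) v → v ≤ N → sumℕ N (λ n → onlyAt (suc n) v (G n)) ≡ prepend 0ℤ G v
sumℕ-δ N       G zero          _         = sumℕ-zero N
sumℕ-δ (suc N) G (suc zero)    _         = trans (cong (G 0 +ℤ_) (sumℕ-zero N)) (ℤ.+-identityʳ (G 0))
sumℕ-δ (suc N) G (suc (suc v)) (s≤s v<N) = trans (ℤ.+-identityˡ _) (sumℕ-δ N (G ∘ suc) (suc v) v<N)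

double : ℕ → ℕ
double zero    = zero
double (suc n) = suc (suc (double n))

edge : ℕ → Parity → ℕ
edge i 0ℙ = double i
edge i 1ℙ = suc (double i)

edge-⌊/2⌋ : ∀ n → edge ⌊ n /2⌋ (parity n) ≡ n
edge-⌊/2⌋ zero          = refl
edge-⌊/2⌋ (suc zero)    = refl
edge-⌊/2⌋ (suc (suc n)) = trans (edge-suc ⌊ n /2⌋ (parity n)) (cong (suc ∘ suc) (edge-⌊/2⌋ n))
  where
  edge-suc : ∀ i p → edge (suc i) p ≡ suc (suc (edge i p))
  edge-suc i 0ℙ = refl
  edge-suc i 1ℙ = refl

⌊edge/2⌋ : ∀ i p → ⌊ edge i p /2⌋ ≡ i
⌊edge/2⌋ zero    0ℙ = refl
⌊edge/2⌋ zero    1ℙ = refl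
⌊edge/2⌋ (suc i) 0ℙ = cong suc (⌊edge/2⌋ i 0ℙ)
⌊edge/2⌋ (suc i) 1ℙ = cong suc (⌊edge/2⌋ i 1ℙ)

parity-edge : ∀ i p → parity (edge i p) ≡ p
parity-edge zero    0ℙ = refl
parity-edge zero    1ℙ = refl
parity-edge (suc i) 0ℙ = parity-edge i 0ℙ
parity-edge (suc i) 1ℙ = parity-edge i 1ℙ

double≡2* : ∀ n → double n ≡ 2 * n
double≡2* zero    = refl
double≡2* (suc n) = cong suc (trans (cong suc (double≡2* n)) (sym (+-suc n (n + 0))))

double-+ : ∀ i k → double i + double k ≡ double (i + k)
double-+ zero    k = refl
double-+ (suc i) k = cong (suc ∘ suc) (double-+ i k)

sumℕ-pairs : ∀ c (G : ℕ → ℤ) → sumℕ (double c) G ≡ sumℕ c (λ k → G (double k) +ℤ G (suc (double k)))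
sumℕ-pairs zero    G = refl
sumℕ-pairs (suc c) G = trans (cong (λ x → G 0 +ℤ (G 1 +ℤ x)) (sumℕ-pairs c (G ∘ suc ∘ suc)))
                             (sym (ℤ.+-assoc (G 0) (G 1) _))

edge-bound : ∀ i k p → edge i p < suc (double k) ⇔ (i ≤ k × (p ≡ 1ℙ → i < k))
edge-bound i k p = mk⇔ (from-bound i k p) (to-bound i k p)
  where
  from-bound : ∀ i k p → edge i p < suc (double k) → i ≤ k × (p ≡ 1ℙ → i < k)
  from-bound zero    k       0ℙ _                 = z≤n , λ ()
  from-bound zero    zero    1ℙ (s<s ())
  from-bound zero    (suc k) 1ℙ _                 = z≤n , λ _ → z<s
  from-bound (suc i) zero    0ℙ (s<s ())
  from-bound (suc i) zero    1ℙ (s<s ())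
  from-bound (suc i) (suc k) 0ℙ (s<s (s<s i<k)) = let (i≤k , odd⇒i<k) = from-bound i k 0ℙ i<k in s≤s i≤k , s<s ∘ odd⇒i<k
  from-bound (suc i) (suc k) 1ℙ (s<s (s<s i<k)) = let (i≤k , odd⇒i<k) = from-bound i k 1ℙ i<k in s≤s i≤k , s<s ∘ odd⇒i<k

  to-bound : ∀ i k p → i ≤ k × (p ≡ 1ℙ → i < k) → edge i p < suc (double k)
  to-bound zero    k       0ℙ _                       = z<s
  to-bound zero    k       1ℙ (_ , odd⇒i<k)           with odd⇒i<k refl
  ... | z<s = s<s z<s
  to-bound (suc i) (suc k) 0ℙ (s≤s i≤k , odd⇒i<k)   = s<s (s<s (to-bound i k 0ℙ (i≤k , λ ())))
  to-bound (suc i) (suc k) 1ℙ (s≤s i≤k , odd⇒i<k)   = s<s (s<s (to-bound i k 1ℙ (i≤k , λ odd → s<s⁻¹ (odd⇒i<k odd))))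

LabelSet-odd : ∀ K z → LabelSet (suc (double K)) z ⇔ ∣ z ∣ ≤ K
LabelSet-odd K z rewrite double≡2* K = mk⇔
  (λ labelSet → proj₂ labelSet K refl)
  (λ bound → (λ k odd≡even → contradiction (sym odd≡even) (even≢odd k K)) ,
             (λ k eq → subst (∣ z ∣ ≤_) (*-cancelˡ-≡ K k 2 (suc-injective eq)) bound))

LabelSet-even : ∀ P z → LabelSet (double P) z ⇔ (z ≢ 0ℤ × ∣ z ∣ ≤ P)
LabelSet-even P z rewrite double≡2* P = mk⇔
  (λ labelSet → proj₁ labelSet P refl)
  (λ (z≢0 , bound) → (λ k eq → z≢0 , subst (∣ z ∣ ≤_) (*-cancelˡ-≡ P k 2 eq) bound) ,
                     (λ k even≡odd → contradiction even≡odd (even≢odd P k)))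

-- f restricts to a bijection from {x | D x} onto {y | P y}.  For D = (_< p G)
-- and P = LabelSet (p G) this is literally VertexLabelingBij G f.
Bij : {A B : Set} → (A → Set) → (B → Set) → (A → B) → Set
Bij D P f =
  (∀ x → D x → P (f x)) ×
  (∀ x x′ → D x → D x′ → f x ≡ f x′ → x ≡ x′) ×
  (∀ y → P y → ∃ λ x → D x × f x ≡ y)

module _ {A B : Set} {D : A → Set} {P : B → Set} where

  inverse⇒bij : (f : A → B) (g : B → A) →
                (∀ x → D x → P (f x) × g (f x) ≡ x) →
                (∀ y → P y → D (g y) × f (g y) ≡ y) → Bij D P f
  inverse⇒bij f g gf fg =
    (λ x Dx → proj₁ (gf x Dx)) ,
    (λ x x′ Dx Dx′ eq → trans (sym (proj₂ (gf x Dx))) (trans (cong g eq) (proj₂ (gf x′ Dx′)))) ,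
    (λ y Py → g y , fg y Py)

  bij-resp : ∀ {Q : B → Set} {f : A → B} → (∀ y → P y ⇔ Q y) → Bij D P f → Bij D Q f
  bij-resp {f = f} P⇔Q (into , inj , onto) =
    (λ x Dx → to (P⇔Q (f x)) (into x Dx)) ,
    inj ,
    (λ y Qy → onto y (from (P⇔Q y) Qy))

  bij-cong : ∀ {f f′ : A → B} → (∀ x → D x → f x ≡ f′ x) → Bij D P f → Bij D P f′
  bij-cong f≗f′ (into , inj , onto) =
    (λ x Dx → subst P (f≗f′ x Dx) (into x Dx)) ,
    (λ x x′ Dx Dx′ eq → inj x x′ Dx Dx′ (trans (f≗f′ x Dx) (trans eq (sym (f≗f′ x′ Dx′))))) ,
    (λ y Py → let (x , Dx , fx≡y) = onto y Py in x , Dx , trans (sym (f≗f′ x Dx)) fx≡y)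

  bij-∘ : ∀ {C : Set} {Q : C → Set} {f : A → B} {σ : B → C} → Bij D P f → Bij P Q σ → Bij D Q (σ ∘ f)
  bij-∘ {f = f} {σ} (into , inj , onto) (intoσ , injσ , ontoσ) =
    (λ x Dx → intoσ (f x) (into x Dx)) ,
    (λ x x′ Dx Dx′ eq → inj x x′ Dx Dx′ (injσ (f x) (f x′) (into x Dx) (into x′ Dx′) eq)) ,
    (λ y Qy → let (z , Pz , σz≡y) = ontoσ y Qy
                  (x , Dx , fx≡z) = onto z Pz
              in x , Dx , trans (cong σ fx≡z) σz≡y)

bij-prepend : ∀ {N} {P : ℤ → Set} {f : ℕ → ℤ} {z₀} → Bij (_< N) P f → ¬ P z₀ →
              Bij (_< suc N) (λ z → z ≡ z₀ ⊎ P z) (prepend z₀ f)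
bij-prepend {P = P} {f = f} {z₀} (into , inj , onto) z₀∉P =
  into′ , inj′ , onto′
  where
  into′ : ∀ n → n < suc _ → prepend z₀ f n ≡ z₀ ⊎ _
  into′ zero    _         = inj₁ refl
  into′ (suc n) (s<s n<N) = inj₂ (into n n<N)

  inj′ : ∀ n n′ → n < suc _ → n′ < suc _ → prepend z₀ f n ≡ prepend z₀ f n′ → n ≡ n′
  inj′ zero    zero     _         _          _  = refl
  inj′ zero    (suc n′) _         (s<s n′<N) eq = contradiction (subst P (sym eq) (into n′ n′<N)) z₀∉P
  inj′ (suc n) zero     (s<s n<N) _          eq = contradiction (subst P eq (into n n<N)) z₀∉P
  inj′ (suc n) (suc n′) (s<s n<N) (s<s n′<N) eq = cong suc (inj n n′ n<N n′<N eq)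

  onto′ : ∀ z → z ≡ z₀ ⊎ _ → ∃ λ n → n < suc _ × prepend z₀ f n ≡ z
  onto′ z (inj₁ z≡z₀) = zero , z<s , sym z≡z₀
  onto′ z (inj₂ Pz)   = let (n , n<N , fn≡z) = onto z Pz in suc n , s<s n<N , fn≡z

bij⇒edgeLabelingBij : ∀ G (f : ℕ → ℤ) → Bij (_< q G) (LabelSet (q G)) f → EdgeLabelingBij G (f ∘ toℕ)
bij⇒edgeLabelingBij G f (into , inj , onto) =
  (λ e → into (toℕ e) (toℕ<n e)) ,
  (λ e e′ eq → toℕ-injective (inj (toℕ e) (toℕ e′) (toℕ<n e) (toℕ<n e′) eq)) ,
  (λ z Pz → let (n , n<q , fn≡z) = onto z Pz in fromℕ< n<q , trans (cong f (toℕ-fromℕ< n<q)) fn≡z)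

onlyAt-∨ : ∀ x y v c → x ≢ y → (if (v ≡ᵇ x) ∨ (v ≡ᵇ y) then c else 0ℤ) ≡ onlyAt x v c +ℤ onlyAt y v c
onlyAt-∨ x y v c x≢y with v ≟ x | v ≟ y
... | yes refl | yes refl = contradiction refl x≢y
... | yes refl | no  v≢y rewrite ≡ᵇ-yes (refl {x = v}) | ≡ᵇ-no v≢y = sym (ℤ.+-identityʳ c)
... | no  v≢x  | yes refl rewrite ≡ᵇ-no v≢x | ≡ᵇ-yes (refl {x = v}) = sym (ℤ.+-identityˡ c)
... | no  v≢x  | no  v≢y rewrite ≡ᵇ-no v≢x | ≡ᵇ-no v≢y = refl

module RootedTree (j a b : ℕ) where

  parent : ℕ → ℕ
  parent = rtParent j a

  parent-root : ∀ {n} → n < 2 + j → parent n ≡ 0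
  parent-root {n} n<2+j rewrite <ᵇ-yes (subst (n <_) (+-comm 2 j) n<2+j) = refl

  parent-u : ∀ {n} → ¬ n < 2 + j → n < 2 + j + a → parent n ≡ suc j
  parent-u {n} n≮2+j n<2+j+a
    rewrite <ᵇ-no (n≮2+j ∘ subst (n <_) (+-comm j 2))
          | <ᵇ-yes (subst (λ k → n < k + a) (+-comm 2 j) n<2+j+a) = +-comm j 1

  parent-w : ∀ {n} → ¬ n < 2 + j + a → parent n ≡ suc (suc j)
  parent-w {n} n≮2+j+a
    rewrite <ᵇ-no (λ n<j+2 → n≮2+j+a (<-≤-trans (subst (n <_) (+-comm j 2) n<j+2) (m≤m+n (2 + j) a)))
          | <ᵇ-no (n≮2+j+a ∘ subst (λ k → n < k + a) (+-comm j 2)) = +-comm j 2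

  -- Every edge goes up, so its two endpoints differ.
  parent<suc : ∀ n → parent n < suc n
  parent<suc n with n <? 2 + j | n <? 2 + j + a
  ... | yes n<2+j | _           = subst (_< suc n) (sym (parent-root n<2+j)) z<s
  ... | no  n≮2+j | yes n<2+j+a = subst (_< suc n) (sym (parent-u n≮2+j n<2+j+a)) (s≤s (<⇒≤ (≮⇒≥ n≮2+j)))
  ... | no  n≮2+j | no  n≮2+j+a = subst (_< suc n) (sym (parent-w n≮2+j+a)) (s≤s (≮⇒≥ n≮2+j))

  -- The part of the induced label of v coming from the edges below v: the
  -- three blocks of child edges of the root, u and w.
  childSum : (ℕ → ℤ) → ℕ → ℤ
  childSum G v =
    onlyAt 0 v (sumℕ (2 + j) G) +ℤ
    (onlyAt (suc j) v (sumℕ a (λ i → G (2 + j + i))) +ℤ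
     onlyAt (suc (suc j)) v (sumℕ b (λ i → G (2 + j + a + i))))

  parentSum : ∀ (G : ℕ → ℤ) v → sumℕ (j + a + b + 2) (λ n → onlyAt (parent n) v (G n)) ≡ childSum G v
  parentSum G v = begin
      sumℕ (j + a + b + 2) H
    ≡⟨ cong (λ N → sumℕ N H) (trans (+-comm (j + a + b) 2) (cong (suc ∘ suc) (+-assoc j a b))) ⟩
      sumℕ (2 + j + (a + b)) H
    ≡⟨ sumℕ-+ (2 + j) (a + b) H ⟩
      sumℕ (2 + j) H +ℤ sumℕ (a + b) (λ i → H (2 + j + i))
    ≡⟨ cong (sumℕ (2 + j) H +ℤ_) (sumℕ-+ a b (λ i → H (2 + j + i))) ⟩
      sumℕ (2 + j) H +ℤ (sumℕ a (λ i → H (2 + j + i)) +ℤ sumℕ b (λ i → H (2 + j + (a + i))))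
    ≡⟨ cong₂ _+ℤ_ rootBlock (cong₂ _+ℤ_ uBlock wBlock) ⟩
      childSum G v
    ∎
    where
    open ≡-Reasoning
    H : ℕ → ℤ
    H n = onlyAt (parent n) v (G n)

    rootBlock : sumℕ (2 + j) H ≡ onlyAt 0 v (sumℕ (2 + j) G)
    rootBlock = trans (sumℕ-cong (2 + j) (λ n n<2+j → cong (λ x → onlyAt x v (G n)) (parent-root n<2+j)))
                      (sumℕ-onlyAt (2 + j) 0 v G)

    uBlock : sumℕ a (λ i → H (2 + j + i)) ≡ onlyAt (suc j) v (sumℕ a (λ i → G (2 + j + i)))
    uBlock = trans (sumℕ-cong a (λ i i<a → cong (λ x → onlyAt x v (G (2 + j + i)))
                                          (parent-u (≤⇒≯ (m≤m+n (2 + j) i)) (+-monoʳ-< (2 + j) i<a))))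
                   (sumℕ-onlyAt a (suc j) v (λ i → G (2 + j + i)))

    wBlock : sumℕ b (λ i → H (2 + j + (a + i))) ≡ onlyAt (suc (suc j)) v (sumℕ b (λ i → G (2 + j + a + i)))
    wBlock = trans (sumℕ-cong b (λ i _ → trans (cong H (sym (+-assoc (2 + j) a i)))
                                              (cong (λ x → onlyAt x v (G (2 + j + a + i)))
                                                    (parent-w (≤⇒≯ (m≤m+n (2 + j + a) i))))))
                   (sumℕ-onlyAt b (suc (suc j)) v (λ i → G (2 + j + a + i)))

  inducedLabel-RT : ∀ (G : ℕ → ℤ) v → v < p (RT j a b) →
                    inducedLabel (RT j a b) (G ∘ toℕ) v ≡ childSum G v +ℤ prepend 0ℤ G v
  inducedLabel-RT G v v<p = begin
      inducedLabel (RT j a b) (G ∘ toℕ) v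
    ≡⟨ sumFin-toℕ (j + a + b + 2) (λ n → if (v ≡ᵇ parent n) ∨ (v ≡ᵇ suc n) then G n else 0ℤ) ⟩
      sumℕ (j + a + b + 2) (λ n → if (v ≡ᵇ parent n) ∨ (v ≡ᵇ suc n) then G n else 0ℤ)
    ≡⟨ sumℕ-cong (j + a + b + 2) (λ n _ → onlyAt-∨ (parent n) (suc n) v (G n) (<⇒≢ (parent<suc n))) ⟩
      sumℕ (j + a + b + 2) (λ n → onlyAt (parent n) v (G n) +ℤ onlyAt (suc n) v (G n))
    ≡⟨ sumℕ-distrib (j + a + b + 2) (λ n → onlyAt (parent n) v (G n)) (λ n → onlyAt (suc n) v (G n)) ⟩
      sumℕ (j + a + b + 2) (λ n → onlyAt (parent n) v (G n)) +ℤ sumℕ (j + a + b + 2) (λ n → onlyAt (suc n) v (G n))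
    ≡⟨ cong₂ _+ℤ_ (parentSum G v) (sumℕ-δ (j + a + b + 2) G v (s≤s⁻¹ (subst (v <_) (+-suc (j + a + b) 2) v<p))) ⟩
      childSum G v +ℤ prepend 0ℤ G v
    ∎
    where open ≡-Reasoning

-- The edge labelling of RT(0^{2m}, a, b) with 2K + 1 edges, for any K ≥ m + 2
-- (here K = m + r + 2); it is built pair by pair.
module EdgeLabelling (m r : ℕ) where

  K : ℕ
  K = suc (suc (m + r))

  -- The hub pair m and the first pair m + 1 of u are complete pairs.
  m<K : m < K
  m<K = s≤s (≤-trans (m≤m+n m r) (n≤1+n _))

  1+m<K : suc m < K
  1+m<K = s<s (s<s (m≤m+n m r))

  signed : Parity → ℕ → ℤ
  signed 0ℙ n = - (+ n)
  signed 1ℙ n = + n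

  ∣signed∣ : ∀ p n → ∣ signed p n ∣ ≡ n
  ∣signed∣ 0ℙ n = ℤ.∣-i∣≡∣i∣ (+ n)
  ∣signed∣ 1ℙ n = refl

  data Role : ℕ → Set where
    rootLeaves : ∀ {i} → i < m → Role i       -- two leaves of the root
    hub        : Role m                        -- the edges from the root to u and w
    firstOfU   : Role (suc m)                  -- the first two leaves of u
    generic    : ∀ {i} → suc m < i → Role i   -- two further leaves of u or of w

  role : ∀ i → Role i
  role i with <-cmp i m
  ... | tri< i<m _ _  = rootLeaves i<m
  ... | tri≈ _ refl _ = hub
  ... | tri> _ _ m<i with i ≟ suc m
  ...   | yes refl    = firstOfU
  ...   | no  i≢1+m   = generic (≤∧≢⇒< m<i (i≢1+m ∘ sym))

  roleLabel : ∀ {i} → Role i → Parity → ℤ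
  roleLabel (rootLeaves {i} _) p  = signed p (2 + i)
  roleLabel hub                0ℙ = 0ℤ
  roleLabel hub                1ℙ = -1ℤ
  roleLabel firstOfU           0ℙ = 1ℤ
  roleLabel firstOfU           1ℙ = + K
  roleLabel (generic {i} _)    p  = signed p i

  label : ℕ → Parity → ℤ
  label i = roleLabel (role i)

  F : ℕ → ℤ
  F n = label ⌊ n /2⌋ (parity n)

  F-edge : ∀ i p → F (edge i p) ≡ label i p
  F-edge i p = cong₂ label (⌊edge/2⌋ i p) (parity-edge i p)

  label-rootLeaves : ∀ {i} p → i < m → label i p ≡ signed p (2 + i)
  label-rootLeaves {i} p i<m with role i
  ... | rootLeaves _ = refl
  ... | hub          = contradiction i<m (<-irrefl refl)
  ... | firstOfU     = contradiction i<m (≤⇒≯ (n≤1+n m))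
  ... | generic m<i  = contradiction (<-trans (<-trans (n<1+n m) m<i) i<m) (<-irrefl refl)

  label-hub : ∀ p → label m p ≡ roleLabel hub p
  label-hub p with role m
  ... | rootLeaves m<m = contradiction m<m (<-irrefl refl)
  ... | hub            = refl
  ... | generic 1+m<m  = contradiction 1+m<m (≤⇒≯ (n≤1+n m))

  label-firstOfU : ∀ p → label (suc m) p ≡ roleLabel firstOfU p
  label-firstOfU p with role (suc m)
  ... | rootLeaves 1+m<m = contradiction 1+m<m (≤⇒≯ (n≤1+n m))
  ... | firstOfU         = refl
  ... | generic 1+m<1+m  = contradiction 1+m<1+m (<-irrefl refl)

  label-generic : ∀ {i} p → suc m < i → label i p ≡ signed p i
  label-generic {i} p 1+m<i with role i
  ... | rootLeaves i<m = contradiction (<-trans (<-trans (n<1+n m) 1+m<i) i<m) (<-irrefl refl)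
  ... | hub            = contradiction (<-trans (n<1+n m) 1+m<i) (<-irrefl refl)
  ... | firstOfU       = contradiction 1+m<i (<-irrefl refl)
  ... | generic _      = refl

  pairSum : ℕ → ℤ
  pairSum i = label i 0ℙ +ℤ label i 1ℙ

  pairSum-cancels : ∀ {i} → i < m ⊎ suc m < i → pairSum i ≡ 0ℤ
  pairSum-cancels {i} i<m⊎1+m<i with role i
  ... | rootLeaves _ = ℤ.+-inverseˡ (+ (2 + i))
  ... | generic _    = ℤ.+-inverseˡ (+ i)
  ... | hub          = contradiction i<m⊎1+m<i [ <-irrefl refl , ≤⇒≯ (n≤1+n m) ]′
  ... | firstOfU     = contradiction i<m⊎1+m<i [ ≤⇒≯ (n≤1+n m) , <-irrefl refl ]′

  pairSum-hub : pairSum m ≡ -1ℤ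
  pairSum-hub = cong₂ _+ℤ_ (label-hub 0ℙ) (label-hub 1ℙ)

  pairSum-firstOfU : pairSum (suc m) ≡ + suc K
  pairSum-firstOfU = cong₂ _+ℤ_ (label-firstOfU 0ℙ) (label-firstOfU 1ℙ)

  sumℕ-F-pairs : ∀ d c → sumℕ (double c) (λ n → F (double d + n)) ≡ sumℕ c (λ k → pairSum (d + k))
  sumℕ-F-pairs d c = trans (sumℕ-pairs c (λ n → F (double d + n)))
                           (sumℕ-cong c (λ k _ → cong₂ _+ℤ_ (onSide k 0ℙ) (onSide k 1ℙ)))
    where
    onSide : ∀ k p → F (double d + edge k p) ≡ label (d + k) p
    onSide k 0ℙ = trans (cong F (double-+ d k)) (F-edge (d + k) 0ℙ)
    onSide k 1ℙ = trans (cong F (trans (+-suc (double d) (double k)) (cong suc (double-+ d k)))) (F-edge (d + k) 1ℙ)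

  pairOfSize : ℕ → ℕ
  pairOfSize y = if y <ᵇ m then y else 2 + y

  label-pairOfSize : ∀ y p → label (pairOfSize y) p ≡ signed p (2 + y)
  label-pairOfSize y p with y <? m
  ... | yes y<m rewrite <ᵇ-yes y<m = label-rootLeaves p y<m
  ... | no  y≮m rewrite <ᵇ-no y≮m  = label-generic p (s<s (s<s (≮⇒≥ y≮m)))

  pairOfSize-≤ : ∀ y → pairOfSize y ≤ 2 + y
  pairOfSize-≤ y with y <ᵇ m
  ... | true  = ≤-trans (n≤1+n y) (n≤1+n (suc y))
  ... | false = ≤-refl

  pairOfSize-rootLeaves : ∀ {y} → y < m → pairOfSize y ≡ y
  pairOfSize-rootLeaves y<m rewrite <ᵇ-yes y<m = refl

  pairOfSize-generic : ∀ {y} → m ≤ y → pairOfSize y ≡ 2 + y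
  pairOfSize-generic m≤y rewrite <ᵇ-no (≤⇒≯ m≤y) = refl

  edgeOf : ℤ → ℕ
  edgeOf (+ zero)          = edge m 0ℙ
  edgeOf (+ suc zero)      = edge (suc m) 0ℙ
  edgeOf (+ suc (suc y))   = if suc (suc y) ≡ᵇ K then edge (suc m) 1ℙ else edge (pairOfSize y) 1ℙ
  edgeOf -[1+ zero ]       = edge m 1ℙ
  edgeOf -[1+ suc y ]      = edge (pairOfSize y) 0ℙ

  edgeOf-signed : ∀ y p → (p ≡ 1ℙ → 2 + y ≢ K) → edgeOf (signed p (2 + y)) ≡ edge (pairOfSize y) p
  edgeOf-signed y 0ℙ _     = refl
  edgeOf-signed y 1ℙ y+2≢K rewrite ≡ᵇ-no (y+2≢K refl) = refl

  inRange : ∀ {i} p → i < K → edge i p < suc (double K)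
  inRange p i<K = from (edge-bound _ K p) (<⇒≤ i<K , λ _ → i<K)

  inRange-even : ∀ {i} → i ≤ K → edge i 0ℙ < suc (double K)
  inRange-even i≤K = from (edge-bound _ K 0ℙ) (i≤K , λ ())

  edgeOf-label : ∀ i p → i ≤ K → (p ≡ 1ℙ → i < K) → ∣ label i p ∣ ≤ K × edgeOf (label i p) ≡ edge i p
  edgeOf-label i p i≤K odd⇒i<K with role i
  edgeOf-label i p i≤K odd⇒i<K | rootLeaves i<m =
    subst (_≤ K) (sym (∣signed∣ p (2 + i))) (<⇒≤ 2+i<K) ,
    trans (edgeOf-signed i p (λ _ → <⇒≢ 2+i<K)) (cong (λ x → edge x p) (pairOfSize-rootLeaves i<m))
    where 2+i<K : 2 + i < K
          2+i<K = ≤-<-trans (s≤s i<m) 1+m<K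
  edgeOf-label _ 0ℙ _ _ | hub      = z≤n , refl
  edgeOf-label _ 1ℙ _ _ | hub      = s≤s z≤n , refl
  edgeOf-label _ 0ℙ _ _ | firstOfU = s≤s z≤n , refl
  edgeOf-label _ 1ℙ _ _ | firstOfU rewrite ≡ᵇ-yes (refl {x = K}) = ≤-refl , refl
  edgeOf-label (suc (suc y)) p i≤K odd⇒i<K | generic (s≤s (s≤s m≤y)) =
    subst (_≤ K) (sym (∣signed∣ p (2 + y))) i≤K ,
    trans (edgeOf-signed y p (λ odd → <⇒≢ (odd⇒i<K odd))) (cong (λ x → edge x p) (pairOfSize-generic m≤y))

  label-edgeOf : ∀ z → ∣ z ∣ ≤ K → edgeOf z < suc (double K) × F (edgeOf z) ≡ z
  label-edgeOf (+ zero)        _ = inRange 0ℙ m<K , trans (F-edge m 0ℙ) (label-hub 0ℙ)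
  label-edgeOf (+ suc zero)    _ = inRange 0ℙ 1+m<K , trans (F-edge (suc m) 0ℙ) (label-firstOfU 0ℙ)
  label-edgeOf -[1+ zero ]     _ = inRange 1ℙ m<K , trans (F-edge m 1ℙ) (label-hub 1ℙ)
  label-edgeOf (+ suc (suc y)) y+2≤K with suc (suc y) ≟ K
  ... | yes y+2≡K rewrite ≡ᵇ-yes y+2≡K =
    inRange 1ℙ 1+m<K , trans (F-edge (suc m) 1ℙ) (trans (label-firstOfU 1ℙ) (cong +_ (sym y+2≡K)))
  ... | no  y+2≢K rewrite ≡ᵇ-no y+2≢K =
    inRange 1ℙ (≤-<-trans (pairOfSize-≤ y) (≤∧≢⇒< y+2≤K y+2≢K)) ,
    trans (F-edge (pairOfSize y) 1ℙ) (label-pairOfSize y 1ℙ)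
  label-edgeOf -[1+ suc y ]    y+2≤K =
    inRange-even (≤-trans (pairOfSize-≤ y) y+2≤K) , trans (F-edge (pairOfSize y) 0ℙ) (label-pairOfSize y 0ℙ)

  F-bij : Bij (_< suc (double K)) (λ z → ∣ z ∣ ≤ K) F
  F-bij = inverse⇒bij F edgeOf leftInverse label-edgeOf
    where
    leftInverse : ∀ n → n < suc (double K) → ∣ F n ∣ ≤ K × edgeOf (F n) ≡ n
    leftInverse n n≤2K =
      let (i≤K , odd⇒i<K) = to (edge-bound ⌊ n /2⌋ K (parity n)) (subst (_< suc (double K)) (sym (edge-⌊/2⌋ n)) n≤2K)
          (bound , inverse) = edgeOf-label ⌊ n /2⌋ (parity n) i≤K odd⇒i<K
      in bound , trans inverse (edge-⌊/2⌋ n)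

  -- The vertex labels are the edge labels with 0 and -1 traded for K + 1 and
  -- -(K + 1): the edges labelled 0 and -1 lead to u and w, whose labels these are.
  swapHub : ℤ → ℤ
  swapHub (+ zero)     = + suc K
  swapHub (+ suc n)    = + suc n
  swapHub -[1+ zero ]  = -[1+ K ]
  swapHub -[1+ suc n ] = -[1+ suc n ]

  swapHub-fixes : ∀ z → z ≢ 0ℤ → z ≢ -1ℤ → swapHub z ≡ z
  swapHub-fixes (+ zero)     z≢0 _    = contradiction refl z≢0
  swapHub-fixes (+ suc n)    _   _    = refl
  swapHub-fixes -[1+ zero ]  _   z≢-1 = contradiction refl z≢-1
  swapHub-fixes -[1+ suc n ] _   _    = refl

  NonRootLabel : ℤ → Set
  NonRootLabel z = z ≢ 0ℤ × z ≢ -1ℤ × ∣ z ∣ ≤ suc K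

  swapHub-bij : Bij (λ z → ∣ z ∣ ≤ K) NonRootLabel swapHub
  swapHub-bij = inverse⇒bij swapHub unswapHub left right
    where
    unswapHub : ℤ → ℤ
    unswapHub (+ n)    = if n ≡ᵇ suc K then 0ℤ else + n
    unswapHub -[1+ n ] = if n ≡ᵇ K then -1ℤ else -[1+ n ]

    left : ∀ z → ∣ z ∣ ≤ K → NonRootLabel (swapHub z) × unswapHub (swapHub z) ≡ z
    left (+ zero)     _ rewrite ≡ᵇ-yes (refl {x = suc K}) = ((λ ()) , (λ ()) , ≤-refl) , refl
    left -[1+ zero ]  _ rewrite ≡ᵇ-yes (refl {x = K})     = ((λ ()) , (λ ()) , ≤-refl) , refl
    left (+ suc n)    n<K   rewrite ≡ᵇ-no (<⇒≢ (s<s n<K)) = ((λ ()) , (λ ()) , ≤-trans n<K (n≤1+n K)) , refl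
    left -[1+ suc n ] n+1<K rewrite ≡ᵇ-no (<⇒≢ n+1<K)     = ((λ ()) , (λ ()) , ≤-trans n+1<K (n≤1+n K)) , refl

    right : ∀ z → NonRootLabel z → ∣ unswapHub z ∣ ≤ K × swapHub (unswapHub z) ≡ z
    right (+ zero)     (z≢0 , _)          = contradiction refl z≢0
    right -[1+ zero ]  (_ , z≢-1 , _)     = contradiction refl z≢-1
    right (+ suc n)    (_ , _ , n<1+K)    with suc n ≟ suc K
    ... | yes n≡K rewrite ≡ᵇ-yes n≡K = z≤n , cong +_ (sym n≡K)
    ... | no  n≢K rewrite ≡ᵇ-no n≢K  = s≤s⁻¹ (≤∧≢⇒< n<1+K n≢K) , refl
    right -[1+ suc n ] (_ , _ , n+1<1+K) with suc n ≟ K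
    ... | yes n+1≡K rewrite ≡ᵇ-yes n+1≡K = s≤s z≤n , cong -[1+_] (sym n+1≡K)
    ... | no  n+1≢K rewrite ≡ᵇ-no n+1≢K  = s≤s⁻¹ (≤∧≢⇒< n+1<1+K (n+1≢K ∘ suc-injective)) , refl

  vertexLabel : ℕ → ℤ
  vertexLabel = prepend -1ℤ (swapHub ∘ F)

  vertexLabel-bij : Bij (_< double (suc K)) (λ z → z ≢ 0ℤ × ∣ z ∣ ≤ suc K) vertexLabel
  vertexLabel-bij =
    bij-resp (λ z → mk⇔ forget (recover z))
             (bij-prepend (bij-∘ F-bij swapHub-bij) (λ (_ , -1≢-1 , _) → -1≢-1 refl))
    where
    forget : ∀ {z} → z ≡ -1ℤ ⊎ NonRootLabel z → z ≢ 0ℤ × ∣ z ∣ ≤ suc K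
    forget (inj₁ refl)                = (λ ()) , s≤s z≤n
    forget (inj₂ (z≢0 , _ , bound)) = z≢0 , bound

    recover : ∀ z → z ≢ 0ℤ × ∣ z ∣ ≤ suc K → z ≡ -1ℤ ⊎ NonRootLabel z
    recover z (z≢0 , bound) with z ℤ.≟ -1ℤ
    ... | yes z≡-1 = inj₁ z≡-1
    ... | no  z≢-1 = inj₂ (z≢0 , z≢-1 , bound)

module Tree (m s t : ℕ) where
  open EdgeLabelling m (s + t)

  j a b : ℕ
  j = double m
  a = double (suc s)
  b = suc (double t)

  open RootedTree j a b

  tree : Graph
  tree = RT j a b

  edgeCount : q tree ≡ suc (double K)
  edgeCount rewrite double≡2* m | double≡2* s | double≡2* t | double≡2* (m + (s + t)) = solve (m ∷ s ∷ t ∷ [])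

  vertexCount : p tree ≡ double (suc K)
  vertexCount = trans (+-suc (j + a + b) 2) (cong suc edgeCount)

  rootSum : sumℕ (2 + j) F ≡ -1ℤ
  rootSum = begin
      sumℕ (double (suc m)) F
    ≡⟨ sumℕ-F-pairs 0 (suc m) ⟩
      sumℕ (suc m) pairSum
    ≡⟨ sumℕ-snoc m pairSum ⟩
      sumℕ m pairSum +ℤ pairSum m
    ≡⟨ cong₂ _+ℤ_ (sumℕ-vanish m (λ i i<m → pairSum-cancels (inj₁ i<m))) pairSum-hub ⟩
      -1ℤ
    ∎
    where open ≡-Reasoning

  uSum : sumℕ a (λ i → F (2 + j + i)) ≡ + suc K
  uSum = begin
      sumℕ (double (suc s)) (λ i → F (double (suc m) + i))
    ≡⟨ sumℕ-F-pairs (suc m) (suc s) ⟩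
      pairSum (suc m + 0) +ℤ sumℕ s (λ k → pairSum (suc m + suc k))
    ≡⟨ cong₂ _+ℤ_ (trans (cong pairSum (+-identityʳ (suc m))) pairSum-firstOfU)
                  (sumℕ-vanish s (λ k _ → pairSum-cancels (inj₂ (m<m+n (suc m) z<s)))) ⟩
      + suc K +ℤ 0ℤ
    ≡⟨ ℤ.+-identityʳ (+ suc K) ⟩
      + suc K
    ∎
    where open ≡-Reasoning

  wSum : sumℕ b (λ i → F (2 + j + a + i)) ≡ - (+ K)
  wSum = begin
      sumℕ (suc (double t)) (λ i → F (double (suc m) + double (suc s) + i))
    ≡⟨ sumℕ-cong (suc (double t)) (λ i _ → cong (λ x → F (x + i)) (double-+ (suc m) (suc s))) ⟩
      sumℕ (suc (double t)) (λ i → F (double c + i))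
    ≡⟨ sumℕ-snoc (double t) (λ i → F (double c + i)) ⟩
      sumℕ (double t) (λ i → F (double c + i)) +ℤ F (double c + double t)
    ≡⟨ cong₂ _+ℤ_ (trans (sumℕ-F-pairs c t) (sumℕ-vanish t (λ k _ → pairSum-cancels (inj₂ (c<c+k k)))))
                  (trans (cong F (double-+ c t)) (F-edge (c + t) 0ℙ)) ⟩
      0ℤ +ℤ label (c + t) 0ℙ
    ≡⟨ ℤ.+-identityˡ _ ⟩
      label (c + t) 0ℙ
    ≡⟨ cong (λ i → label i 0ℙ) c+t≡K ⟩
      label K 0ℙ
    ≡⟨ label-generic 0ℙ 1+m<K ⟩
      - (+ K)
    ∎
    where
    open ≡-Reasoning
    -- the pairs of w's leaves start at pair c
    c : ℕ
    c = suc m + suc s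

    c<c+k : ∀ k → suc m < c + k
    c<c+k k = <-≤-trans (m<m+n (suc m) z<s) (m≤m+n c k)

    c+t≡K : c + t ≡ K
    c+t≡K = arith m s t
      where arith : ∀ m s t → suc m + suc s + t ≡ suc (suc (m + (s + t)))
            arith = solve-∀

  -- The edges to u and w, which carry the hub labels.
  F-toU : F j ≡ 0ℤ
  F-toU = trans (F-edge m 0ℙ) (label-hub 0ℙ)

  F-toW : F (suc j) ≡ -1ℤ
  F-toW = trans (F-edge m 1ℙ) (label-hub 1ℙ)

  nonRootLabel : ∀ n → n < suc (double K) →
                 (onlyAt j n (+ suc K) +ℤ onlyAt (suc j) n (- (+ K))) +ℤ F n ≡ swapHub (F n)
  nonRootLabel n n≤2K with n ≟ j | n ≟ suc j
  ... | yes refl | _ rewrite ≡ᵇ-yes (refl {x = j}) | ≡ᵇ-no (<⇒≢ (n<1+n j)) | F-toU =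
    trans (ℤ.+-identityʳ _) (ℤ.+-identityʳ _)
  ... | no n≢j | yes refl rewrite ≡ᵇ-no n≢j | ≡ᵇ-yes (refl {x = suc j}) | F-toW =
    cong (λ x → -[1+ suc x ]) (+-identityʳ (suc (m + (s + t))))
  ... | no n≢j | no n≢1+j rewrite ≡ᵇ-no n≢j | ≡ᵇ-no n≢1+j =
    trans (ℤ.+-identityˡ (F n))
          (sym (swapHub-fixes (F n) (λ Fn≡0 → n≢j (injective (inRange 0ℙ m<K) (trans Fn≡0 (sym F-toU))))
                                    (λ Fn≡-1 → n≢1+j (injective (inRange 1ℙ m<K) (trans Fn≡-1 (sym F-toW))))))
    where
    -- only the hub edges carry the labels 0 and -1
    injective : ∀ {n′} → n′ < suc (double K) → F n ≡ F n′ → n ≡ n′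
    injective n′≤2K = proj₁ (proj₂ F-bij) n _ n≤2K n′≤2K

  inducedLabel≡vertexLabel : ∀ v → v < p tree → inducedLabel tree (F ∘ toℕ) v ≡ vertexLabel v
  inducedLabel≡vertexLabel v v<p = begin
      inducedLabel tree (F ∘ toℕ) v
    ≡⟨ inducedLabel-RT F v v<p ⟩
      childSum F v +ℤ prepend 0ℤ F v
    ≡⟨ cong (_+ℤ prepend 0ℤ F v) (cong₂ _+ℤ_ (cong (onlyAt 0 v) rootSum)
                                   (cong₂ _+ℤ_ (cong (onlyAt (suc j) v) uSum) (cong (onlyAt (suc (suc j)) v) wSum))) ⟩
      (onlyAt 0 v -1ℤ +ℤ (onlyAt (suc j) v (+ suc K) +ℤ onlyAt (suc (suc j)) v (- (+ K)))) +ℤ prepend 0ℤ F v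
    ≡⟨ byVertex v v<p ⟩
      vertexLabel v
    ∎
    where
    open ≡-Reasoning
    byVertex : ∀ v → v < p tree →
               (onlyAt 0 v -1ℤ +ℤ (onlyAt (suc j) v (+ suc K) +ℤ onlyAt (suc (suc j)) v (- (+ K)))) +ℤ prepend 0ℤ F v
               ≡ vertexLabel v
    byVertex zero    _   = refl
    byVertex (suc n) n<p = trans (cong (_+ℤ F n) (ℤ.+-identityˡ (onlyAt j n (+ suc K) +ℤ onlyAt (suc j) n (- (+ K)))))
                                 (nonRootLabel n (s<s⁻¹ (subst (suc n <_) vertexCount n<p)))

  superEdgeGraceful : SuperEdgeGraceful tree
  superEdgeGraceful = F ∘ toℕ , edgeBij , vertexBij
    where
    edgeBij : EdgeLabelingBij tree (F ∘ toℕ)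
    edgeBij = bij⇒edgeLabelingBij tree F
                (subst (λ N → Bij (_< N) (LabelSet N) F) (sym edgeCount)
                       (bij-resp (λ z → ⇔.sym (LabelSet-odd K z)) F-bij))

    vertexBij : VertexLabelingBij tree (inducedLabel tree (F ∘ toℕ))
    vertexBij = bij-cong (λ v v<p → sym (inducedLabel≡vertexLabel v v<p))
                  (subst (λ N → Bij (_< N) (LabelSet N) vertexLabel) (sym vertexCount)
                         (bij-resp (λ z → ⇔.sym (LabelSet-even (suc K) z)) vertexLabel-bij))

lemma3 : (j a b : ℕ) → (∃ λ m → j ≡ 2 * m) → (∃ λ m → a ≡ 2 * m) → 2 ≤ a → (∃ λ m → b ≡ suc (2 * m)) → SuperEdgeGraceful (RT j a b)
lemma3 _ _ _ (m , refl) (zero  , refl) () _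
lemma3 _ _ _ (m , refl) (suc s , refl) _ (t , refl)
  rewrite sym (double≡2* m) | sym (double≡2* (suc s)) | sym (double≡2* t) = Tree.superEdgeGraceful m s t
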